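{- None of the following formulas (with $p,q,r$ propositional variables) is provable in Nelson's logic $\mathcal S$: (1) $p\lor\neg p$; (2) $\neg(p\land\neg p)$; (3) $(p\land\neg p)\Rightarrow q$; (4) $(p\Rightarrow(p\Rightarrow q))\Rightarrow(p\Rightarrow q)$; (5) $(p\Rightarrow(q\Rightarrow r))\Rightarrow((p\land q)\Rightarrow r)$; (6) $(p\land\neg q)\Rightarrow\neg(p\Rightarrow q)$; (7) $((p\Rightarrow q)\Rightarrow q)\Rightarrow((q\Rightarrow p)\Rightarrow p)$; (8) $(p\land(q\lor r))\Rightarrow((p\land q)\lor(p\land r))$; (9) $((p^2\Rightarrow q)\land((\neg q)^2\Rightarrow\neg p))\Rightarrow(p\Rightarrow q)$, where $\varphi^2:=\neg(\varphi\Rightarrow\neg\varphi)$.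
   Context: Nelson's logic $\mathcal S$ is the sentential logic in the language $\langle\land,\lor,\Rightarrow,\neg,0\rangle$ (types $2,2,2,1,0$) given by the following Hilbert-style calculus. Abbreviations: $\phi\Leftrightarrow\psi:=(\phi\Rightarrow\psi)\land(\psi\Rightarrow\phi)$, $1:=\neg 0$, $\phi\Rightarrow^2\psi:=\phi\Rightarrow(\phi\Rightarrow\psi)$; for a finite (possibly empty) list $\Gamma=(\phi_1,\dots,\phi_n)$ of formulas, $\Gamma\Rightarrow\phi:=\phi_1\Rightarrow(\phi_2\Rightarrow(\cdots(\phi_n\Rightarrow\phi)\cdots))$ and $\Gamma\Rightarrow^2\phi:=\phi_1\Rightarrow^2(\phi_2\Rightarrow^2(\cdots(\phi_n\Rightarrow^2\phi)\cdots))$, both being $\phi$ if $\Gamma$ is empty. Axiom schemata: (A1) $\phi\Rightarrow\phi$; (A2) $0\Rightarrow\psi$; (A3) $\neg\phi\Rightarrow(\phi\Rightarrow0)$; (A4) $1$; (A5) $(\phi\Rightarrow\psi)\Leftrightarrow(\neg\psi\Rightarrow\neg\phi)$. Rule schemata (for all formulas and every finite list $\Gamma$), written "premisses / conclusion": (P) $\Gamma\Rightarrow(\phi\Rightarrow(\psi\Rightarrow\gamma))$ / $\Gamma\Rightarrow(\psi\Rightarrow(\phi\Rightarrow\gamma))$; (C) $\phi\Rightarrow(\phi\Rightarrow(\phi\Rightarrow\gamma))$ / $\phi\Rightarrow(\phi\Rightarrow\gamma)$; (E) $\Gamma\Rightarrow\phi$, $\phi\Rightarrow\gamma$ / $\Gamma\Rightarrow\gamma$;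 ($\Rightarrow$l) $\Gamma\Rightarrow\phi$, $\psi\Rightarrow\gamma$ / $\Gamma\Rightarrow((\phi\Rightarrow\psi)\Rightarrow\gamma)$; ($\Rightarrow$r) $\gamma$ / $\phi\Rightarrow\gamma$; ($\land$l1) $\phi\Rightarrow\gamma$ / $(\phi\land\psi)\Rightarrow\gamma$; ($\land$l2) $\psi\Rightarrow\gamma$ / $(\phi\land\psi)\Rightarrow\gamma$; ($\land$r) $\Gamma\Rightarrow\phi$, $\Gamma\Rightarrow\psi$ / $\Gamma\Rightarrow(\phi\land\psi)$; ($\lor$l1) $\phi\Rightarrow\gamma$, $\psi\Rightarrow\gamma$ / $(\phi\lor\psi)\Rightarrow\gamma$; ($\lor$l2) $\phi\Rightarrow^2\gamma$, $\psi\Rightarrow^2\gamma$ / $(\phi\lor\psi)\Rightarrow^2\gamma$; ($\lor$r1) $\Gamma\Rightarrow\phi$ / $\Gamma\Rightarrow(\phi\lor\psi)$; ($\lor$r2) $\Gamma\Rightarrow\psi$ / $\Gamma\Rightarrow(\phi\lor\psi)$; ($\neg\Rightarrow$l) $(\phi\land\neg\psi)\Rightarrow\gamma$ / $\neg(\phi\Rightarrow\psi)\Rightarrow\gamma$; ($\neg\Rightarrow$r) $\Gamma\Rightarrow^2(\phi\land\neg\psi)$ / $\Gamma\Rightarrow^2\neg(\phi\Rightarrow\psi)$; ($\neg\land$l) $(\neg\phi\lor\neg\psi)\Rightarrow\gamma$ / $\neg(\phi\land\psi)\Rightarrow\gamma$; ($\neg\land$r) $\Gamma\Rightarrow(\neg\phi\lor\neg\psi)$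 / $\Gamma\Rightarrow\neg(\phi\land\psi)$; ($\neg\lor$l) $(\neg\phi\land\neg\psi)\Rightarrow\gamma$ / $\neg(\phi\lor\psi)\Rightarrow\gamma$; ($\neg\lor$r) $\Gamma\Rightarrow(\neg\phi\land\neg\psi)$ / $\Gamma\Rightarrow\neg(\phi\lor\psi)$; ($\neg\neg$l) $\phi\Rightarrow\gamma$ / $\neg\neg\phi\Rightarrow\gamma$; ($\neg\neg$r) $\Gamma\Rightarrow\phi$ / $\Gamma\Rightarrow\neg\neg\phi$. A formula is provable if it is derivable in this calculus from no premisses. -}

module Defs where

open import Data.Nat using (ℕ)
open import Data.List using (List; []; _∷_; foldr)

infixr 5 _⇒_
infixr 6 _∨_
infixr 7 _∧_
infix 9 ∼_
infixr 5 _⇒²_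
infixr 4 _⇛_ _⇛²_
infix 3 _⇔_
infix 10 _²
data Form : Set where
  var  : ℕ → Form
  _∧_  : Form → Form → Form
  _∨_  : Form → Form → Form
  _⇒_  : Form → Form → Form
  ∼_   : Form → Form
  𝟘    : Form

_⇔_ : Form → Form → Form
φ ⇔ ψ = (φ ⇒ ψ) ∧ (ψ ⇒ φ)

𝟙 : Form
𝟙 = ∼ 𝟘

_⇒²_ : Form → Form → Form
φ ⇒² ψ = φ ⇒ (φ ⇒ ψ)

_⇛_ : List Form → Form → Form
Γ ⇛ φ = foldr _⇒_ φ Γ

_⇛²_ : List Form → Form → Form
Γ ⇛² φ = foldr _⇒²_ φ Γ

data Prov : Form → Set where
  A1 : ∀ φ → Prov (φ ⇒ φ)
  A2 : ∀ ψ → Prov (𝟘 ⇒ ψ)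
  A3 : ∀ φ → Prov (∼ φ ⇒ (φ ⇒ 𝟘))
  A4 : Prov 𝟙
  A5 : ∀ φ ψ → Prov ((φ ⇒ ψ) ⇔ (∼ ψ ⇒ ∼ φ))
  P  : ∀ Γ φ ψ γ → Prov (Γ ⇛ (φ ⇒ (ψ ⇒ γ))) → Prov (Γ ⇛ (ψ ⇒ (φ ⇒ γ)))
  C  : ∀ φ γ → Prov (φ ⇒ (φ ⇒ (φ ⇒ γ))) → Prov (φ ⇒ (φ ⇒ γ))
  E  : ∀ Γ φ γ → Prov (Γ ⇛ φ) → Prov (φ ⇒ γ) → Prov (Γ ⇛ γ)
  ⇒l : ∀ Γ φ ψ γ → Prov (Γ ⇛ φ) → Prov (ψ ⇒ γ) → Prov (Γ ⇛ ((φ ⇒ ψ) ⇒ γ))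
  ⇒r : ∀ φ γ → Prov γ → Prov (φ ⇒ γ)
  ∧l1 : ∀ φ ψ γ → Prov (φ ⇒ γ) → Prov ((φ ∧ ψ) ⇒ γ)
  ∧l2 : ∀ φ ψ γ → Prov (ψ ⇒ γ) → Prov ((φ ∧ ψ) ⇒ γ)
  ∧r  : ∀ Γ φ ψ → Prov (Γ ⇛ φ) → Prov (Γ ⇛ ψ) → Prov (Γ ⇛ (φ ∧ ψ))
  ∨l1 : ∀ φ ψ γ → Prov (φ ⇒ γ) → Prov (ψ ⇒ γ) → Prov ((φ ∨ ψ) ⇒ γ)
  ∨l2 : ∀ φ ψ γ → Prov (φ ⇒² γ) → Prov (ψ ⇒² γ) → Prov ((φ ∨ ψ) ⇒² γ)
  ∨r1 : ∀ Γ φ ψ → Prov (Γ ⇛ φ) → Prov (Γ ⇛ (φ ∨ ψ))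
  ∨r2 : ∀ Γ φ ψ → Prov (Γ ⇛ ψ) → Prov (Γ ⇛ (φ ∨ ψ))
  ¬⇒l : ∀ φ ψ γ → Prov ((φ ∧ ∼ ψ) ⇒ γ) → Prov (∼ (φ ⇒ ψ) ⇒ γ)
  ¬⇒r : ∀ Γ φ ψ → Prov (Γ ⇛² (φ ∧ ∼ ψ)) → Prov (Γ ⇛² ∼ (φ ⇒ ψ))
  ¬∧l : ∀ φ ψ γ → Prov ((∼ φ ∨ ∼ ψ) ⇒ γ) → Prov (∼ (φ ∧ ψ) ⇒ γ)
  ¬∧r : ∀ Γ φ ψ → Prov (Γ ⇛ (∼ φ ∨ ∼ ψ)) → Prov (Γ ⇛ ∼ (φ ∧ ψ))
  ¬∨l : ∀ φ ψ γ → Prov ((∼ φ ∧ ∼ ψ) ⇒ γ) → Prov (∼ (φ ∨ ψ) ⇒ γ)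
  ¬∨r : ∀ Γ φ ψ → Prov (Γ ⇛ (∼ φ ∧ ∼ ψ)) → Prov (Γ ⇛ ∼ (φ ∨ ψ))
  ¬¬l : ∀ φ γ → Prov (φ ⇒ γ) → Prov (∼ ∼ φ ⇒ γ)
  ¬¬r : ∀ Γ φ → Prov (Γ ⇛ φ) → Prov (Γ ⇛ ∼ ∼ φ)

_² : Form → Form
φ ² = ∼ (φ ⇒ ∼ φ)

p q r : Form
p = var 0
q = var 1
r = var 2

module Submission where

-- Unprovability in Nelson's logic S via an algebraic countermodel.
--
-- An S-model is a set of truth values with operations interpreting the
-- connectives, a set of designated values, and a commutative, associative,
-- 3-potent product · that curries implication:  x ⊸ (y ⊸ z) = (x · y) ⊸ z.
-- The product interprets a list of hypotheses Γ, which turns every rule with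
-- a context into a statement about a single value ⟦Γ⟧; the doubled context
-- Γ ⇛² φ of rule (¬⇒r) is interpreted by an idempotent value, which is why
-- that rule only needs to be valid for idempotent contexts.

open import Defs
open import Data.Nat using (ℕ; zero; suc)
open import Data.Fin using (Fin; _≟_)
open import Data.Fin.Properties using (all?)
import Data.Fin.Literals as Fin
open import Data.List using (List; []; _∷_; foldr)
open import Data.Vec using (Vec; []; _∷_; lookup)
open import Data.Product using (_×_; _,_)
open import Relation.Nullary using (¬_; Dec)
open import Relation.Nullary.Decidable using (True; toWitness; _→-dec_)
open import Relation.Binary.PropositionalEquality
  using (_≡_; refl; sym; cong; cong₂; subst; isEquivalence; module ≡-Reasoning)
import Algebra.Properties.CommutativeSemigroup as CommSemigroupProperties
open import Algebra.Bundles using (CommutativeSemigroup)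

-- An S-model.  The entailment x ≤ y means "x ⊸ y is designated"; each law
-- below is the semantic counterpart of one axiom or rule of S.
record Model : Set₁ where
  infixr 5 _⊸_
  infixr 6 _⊔_
  infixr 7 _⊓_
  infixr 8 _·_
  infix 9 −_
  infix 4 _≤_
  field
    Carrier          : Set
    _⊸_ _⊓_ _⊔_ _·_  : Carrier → Carrier → Carrier
    −_               : Carrier → Carrier
    ⊥ ⊤              : Carrier
    Designated       : Carrier → Set

  _≤_ : Carrier → Carrier → Set
  x ≤ y = Designated (x ⊸ y)

  field
    ·-comm       : ∀ x y → x · y ≡ y · x
    ·-assoc      : ∀ x y z → (x · y) · z ≡ x · (y · z)
    ·-3-potent   : ∀ x → x · x · x ≡ x · x
    ·-identityˡ  : ∀ x → ⊤ · x ≡ x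
    ⊸-curry      : ∀ x y z → x ⊸ y ⊸ z ≡ (x · y) ⊸ z
    ⊤-⊸          : ∀ x → ⊤ ⊸ x ≡ x
    -- (A1)-(A5), (E) and (⇒r)
    ≤-refl       : ∀ x → x ≤ x
    ≤-trans      : ∀ {x y z} → x ≤ y → y ≤ z → x ≤ z
    ⊥-least      : ∀ x → ⊥ ≤ x
    −-⊸⊥         : ∀ x → − x ≤ x ⊸ ⊥
    −⊥-designated : Designated (− ⊥)
    contrapose   : ∀ x y → x ⊸ y ≤ − y ⊸ − x
    contrapose⁻¹ : ∀ x y → − y ⊸ − x ≤ x ⊸ y
    designated-⊸ : ∀ {x} y → Designated x → y ≤ x
    -- (⇒l)
    ⊸-left       : ∀ {c x y z} → c ≤ x → y ≤ z → c ≤ (x ⊸ y) ⊸ z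
    -- lattice rules; (∨l2) is the doubled form of (∨l1)
    ⊓-lowerˡ     : ∀ x y → x ⊓ y ≤ x
    ⊓-lowerʳ     : ∀ x y → x ⊓ y ≤ y
    ⊓-greatest   : ∀ {c x y} → c ≤ x → c ≤ y → c ≤ x ⊓ y
    ⊔-upperˡ     : ∀ x y → x ≤ x ⊔ y
    ⊔-upperʳ     : ∀ x y → y ≤ x ⊔ y
    ⊔-least      : ∀ {x y z} → x ≤ z → y ≤ z → x ⊔ y ≤ z
    ⊔-least²     : ∀ {x y z} → x ≤ x ⊸ z → y ≤ y ⊸ z → x ⊔ y ≤ (x ⊔ y) ⊸ z
    −⊸-elim      : ∀ x y → − (x ⊸ y) ≤ x ⊓ − y
    −⊸-intro     : ∀ {c x y} → c · c ≡ c → c ≤ x ⊓ − y → c ≤ − (x ⊸ y)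
    −⊓-elim      : ∀ x y → − (x ⊓ y) ≤ − x ⊔ − y
    −⊓-intro     : ∀ x y → − x ⊔ − y ≤ − (x ⊓ y)
    −⊔-elim      : ∀ x y → − (x ⊔ y) ≤ − x ⊓ − y
    −⊔-intro     : ∀ x y → − x ⊓ − y ≤ − (x ⊔ y)
    −−-elim      : ∀ x → − − x ≤ x
    −−-intro     : ∀ x → x ≤ − − x

module ModelProperties (M : Model) where
  open Model M
  open ≡-Reasoning

  -- the product is a commutative semigroup on ≡, so the library's
  -- rearrangement lemmas apply to it
  ·-commutativeSemigroup : CommutativeSemigroup _ _
  ·-commutativeSemigroup = record
    { _∙_ = _·_
    ; isCommutativeSemigroup = record
      { isSemigroup = record
        { isMagma = record { isEquivalence = isEquivalence ; ∙-cong = cong₂ _·_ }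
        ; assoc   = ·-assoc }
      ; comm = ·-comm } }

  open CommSemigroupProperties ·-commutativeSemigroup using (interchange)

  -- designated values are closed under meets: (⊓-greatest) in the empty context
  ⊓-designated : ∀ {x y} → Designated x → Designated y → Designated (x ⊓ y)
  ⊓-designated {x} {y} dx dy =
    subst Designated (⊤-⊸ (x ⊓ y))
      (⊓-greatest (subst Designated (sym (⊤-⊸ x)) dx) (subst Designated (sym (⊤-⊸ y)) dy))

  -- hypotheses may be exchanged: the semantic content of rule (P)
  ⊸-exchange : ∀ x y z → x ⊸ y ⊸ z ≡ y ⊸ x ⊸ z
  ⊸-exchange x y z = begin
    x ⊸ y ⊸ z    ≡⟨ ⊸-curry x y z ⟩
    (x · y) ⊸ z  ≡⟨ cong (_⊸ z) (·-comm x y) ⟩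
    (y · x) ⊸ z  ≡⟨ ⊸-curry y x z ⟨
    y ⊸ x ⊸ z    ∎

  -- a triple hypothesis is a double one: the semantic content of rule (C)
  ⊸-contract : ∀ x z → x ⊸ x ⊸ x ⊸ z ≡ x ⊸ x ⊸ z
  ⊸-contract x z = begin
    x ⊸ x ⊸ x ⊸ z      ≡⟨ cong (x ⊸_) (⊸-curry x x z) ⟩
    x ⊸ (x · x) ⊸ z    ≡⟨ ⊸-curry x (x · x) z ⟩
    (x · x · x) ⊸ z    ≡⟨ cong (_⊸ z) (·-3-potent x) ⟩
    (x · x) ⊸ z        ≡⟨ ⊸-curry x x z ⟨
    x ⊸ x ⊸ z          ∎

  square-idempotent : ∀ x → (x · x) · (x · x) ≡ x · x
  square-idempotent x = begin
    (x · x) · (x · x)  ≡⟨ ·-assoc x x (x · x) ⟩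
    x · x · x · x      ≡⟨ cong (x ·_) (·-3-potent x) ⟩
    x · x · x          ≡⟨ ·-3-potent x ⟩
    x · x              ∎

  doubled-idempotent : ∀ g {c} → c · c ≡ c → (g · g · c) · (g · g · c) ≡ g · g · c
  doubled-idempotent g {c} c-idem = begin
    (g · g · c) · (g · g · c)          ≡⟨ cong₂ _·_ (·-assoc g g c) (·-assoc g g c) ⟨
    ((g · g) · c) · ((g · g) · c)      ≡⟨ interchange (g · g) c (g · g) c ⟩
    ((g · g) · (g · g)) · (c · c)      ≡⟨ cong₂ _·_ (square-idempotent g) c-idem ⟩
    (g · g) · c                        ≡⟨ ·-assoc g g c ⟩
    g · g · c                          ∎

module Soundness (M : Model) where
  open Model M
  open ModelProperties M
  open ≡-Reasoning

  Valuation : Set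
  Valuation = ℕ → Carrier

  ⟦_⟧ : Form → Valuation → Carrier
  ⟦ var n ⟧ ρ = ρ n
  ⟦ φ ∧ ψ ⟧ ρ = ⟦ φ ⟧ ρ ⊓ ⟦ ψ ⟧ ρ
  ⟦ φ ∨ ψ ⟧ ρ = ⟦ φ ⟧ ρ ⊔ ⟦ ψ ⟧ ρ
  ⟦ φ ⇒ ψ ⟧ ρ = ⟦ φ ⟧ ρ ⊸ ⟦ ψ ⟧ ρ
  ⟦ ∼ φ ⟧ ρ   = − ⟦ φ ⟧ ρ
  ⟦ 𝟘 ⟧ ρ     = ⊥

  module _ (ρ : Valuation) where

    context : List Form → Carrier
    context = foldr (λ γ c → ⟦ γ ⟧ ρ · c) ⊤

    context² : List Form → Carrier
    context² = foldr (λ γ c → ⟦ γ ⟧ ρ · ⟦ γ ⟧ ρ · c) ⊤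

    ⇛-meaning : ∀ Γ φ → ⟦ Γ ⇛ φ ⟧ ρ ≡ context Γ ⊸ ⟦ φ ⟧ ρ
    ⇛-meaning []      φ = sym (⊤-⊸ (⟦ φ ⟧ ρ))
    ⇛-meaning (γ ∷ Γ) φ = begin
      ⟦ γ ⟧ ρ ⊸ ⟦ Γ ⇛ φ ⟧ ρ              ≡⟨ cong (⟦ γ ⟧ ρ ⊸_) (⇛-meaning Γ φ) ⟩
      ⟦ γ ⟧ ρ ⊸ context Γ ⊸ ⟦ φ ⟧ ρ       ≡⟨ ⊸-curry (⟦ γ ⟧ ρ) (context Γ) (⟦ φ ⟧ ρ) ⟩
      (⟦ γ ⟧ ρ · context Γ) ⊸ ⟦ φ ⟧ ρ    ∎

    ⇛²-meaning : ∀ Γ φ → ⟦ Γ ⇛² φ ⟧ ρ ≡ context² Γ ⊸ ⟦ φ ⟧ ρ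
    ⇛²-meaning []      φ = sym (⊤-⊸ (⟦ φ ⟧ ρ))
    ⇛²-meaning (γ ∷ Γ) φ = begin
      g ⊸ g ⊸ ⟦ Γ ⇛² φ ⟧ ρ           ≡⟨ cong (λ v → g ⊸ g ⊸ v) (⇛²-meaning Γ φ) ⟩
      g ⊸ g ⊸ context² Γ ⊸ ⟦ φ ⟧ ρ    ≡⟨ cong (g ⊸_) (⊸-curry g (context² Γ) (⟦ φ ⟧ ρ)) ⟩
      g ⊸ (g · context² Γ) ⊸ ⟦ φ ⟧ ρ  ≡⟨ ⊸-curry g (g · context² Γ) (⟦ φ ⟧ ρ) ⟩
      (g · g · context² Γ) ⊸ ⟦ φ ⟧ ρ  ∎
      where g = ⟦ γ ⟧ ρ

    context²-idempotent : ∀ Γ → context² Γ · context² Γ ≡ context² Γ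
    context²-idempotent []      = ·-identityˡ ⊤
    context²-idempotent (γ ∷ Γ) = doubled-idempotent (⟦ γ ⟧ ρ) (context²-idempotent Γ)

    from-context : ∀ Γ {φ} → context Γ ≤ ⟦ φ ⟧ ρ → Designated (⟦ Γ ⇛ φ ⟧ ρ)
    from-context Γ {φ} = subst Designated (sym (⇛-meaning Γ φ))

    to-context : ∀ Γ {φ} → Designated (⟦ Γ ⇛ φ ⟧ ρ) → context Γ ≤ ⟦ φ ⟧ ρ
    to-context Γ {φ} = subst Designated (⇛-meaning Γ φ)

    from-context² : ∀ Γ {φ} → context² Γ ≤ ⟦ φ ⟧ ρ → Designated (⟦ Γ ⇛² φ ⟧ ρ)
    from-context² Γ {φ} = subst Designated (sym (⇛²-meaning Γ φ))

    to-context² : ∀ Γ {φ} → Designated (⟦ Γ ⇛² φ ⟧ ρ) → context² Γ ≤ ⟦ φ ⟧ ρ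
    to-context² Γ {φ} = subst Designated (⇛²-meaning Γ φ)

    ⇛-cong : ∀ Γ {φ ψ} → ⟦ φ ⟧ ρ ≡ ⟦ ψ ⟧ ρ → ⟦ Γ ⇛ φ ⟧ ρ ≡ ⟦ Γ ⇛ ψ ⟧ ρ
    ⇛-cong []      eq = eq
    ⇛-cong (γ ∷ Γ) eq = cong (⟦ γ ⟧ ρ ⊸_) (⇛-cong Γ eq)

  sound : ∀ {φ} → Prov φ → ∀ ρ → Designated (⟦ φ ⟧ ρ)
  sound (A1 φ) ρ = ≤-refl (⟦ φ ⟧ ρ)
  sound (A2 ψ) ρ = ⊥-least (⟦ ψ ⟧ ρ)
  sound (A3 φ) ρ = −-⊸⊥ (⟦ φ ⟧ ρ)
  sound A4 ρ = −⊥-designated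
  sound (A5 φ ψ) ρ = ⊓-designated (contrapose x y) (contrapose⁻¹ x y)
    where x = ⟦ φ ⟧ ρ ; y = ⟦ ψ ⟧ ρ
  sound (P Γ φ ψ γ d) ρ =
    subst Designated (⇛-cong ρ Γ (⊸-exchange (⟦ φ ⟧ ρ) (⟦ ψ ⟧ ρ) (⟦ γ ⟧ ρ))) (sound d ρ)
  sound (C φ γ d) ρ = subst Designated (⊸-contract (⟦ φ ⟧ ρ) (⟦ γ ⟧ ρ)) (sound d ρ)
  sound (E Γ φ γ d e) ρ = from-context ρ Γ (≤-trans (to-context ρ Γ (sound d ρ)) (sound e ρ))
  sound (⇒l Γ φ ψ γ d e) ρ = from-context ρ Γ (⊸-left (to-context ρ Γ (sound d ρ)) (sound e ρ))
  sound (⇒r φ γ d) ρ = designated-⊸ (⟦ φ ⟧ ρ) (sound d ρ)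
  sound (∧l1 φ ψ γ d) ρ = ≤-trans (⊓-lowerˡ (⟦ φ ⟧ ρ) (⟦ ψ ⟧ ρ)) (sound d ρ)
  sound (∧l2 φ ψ γ d) ρ = ≤-trans (⊓-lowerʳ (⟦ φ ⟧ ρ) (⟦ ψ ⟧ ρ)) (sound d ρ)
  sound (∧r Γ φ ψ d e) ρ =
    from-context ρ Γ (⊓-greatest (to-context ρ Γ (sound d ρ)) (to-context ρ Γ (sound e ρ)))
  sound (∨l1 φ ψ γ d e) ρ = ⊔-least (sound d ρ) (sound e ρ)
  sound (∨l2 φ ψ γ d e) ρ = ⊔-least² (sound d ρ) (sound e ρ)
  sound (∨r1 Γ φ ψ d) ρ =
    from-context ρ Γ (≤-trans (to-context ρ Γ (sound d ρ)) (⊔-upperˡ (⟦ φ ⟧ ρ) (⟦ ψ ⟧ ρ)))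
  sound (∨r2 Γ φ ψ d) ρ =
    from-context ρ Γ (≤-trans (to-context ρ Γ (sound d ρ)) (⊔-upperʳ (⟦ φ ⟧ ρ) (⟦ ψ ⟧ ρ)))
  sound (¬⇒l φ ψ γ d) ρ = ≤-trans (−⊸-elim (⟦ φ ⟧ ρ) (⟦ ψ ⟧ ρ)) (sound d ρ)
  sound (¬⇒r Γ φ ψ d) ρ =
    from-context² ρ Γ (−⊸-intro (context²-idempotent ρ Γ) (to-context² ρ Γ (sound d ρ)))
  sound (¬∧l φ ψ γ d) ρ = ≤-trans (−⊓-elim (⟦ φ ⟧ ρ) (⟦ ψ ⟧ ρ)) (sound d ρ)
  sound (¬∧r Γ φ ψ d) ρ =
    from-context ρ Γ (≤-trans (to-context ρ Γ (sound d ρ)) (−⊓-intro (⟦ φ ⟧ ρ) (⟦ ψ ⟧ ρ)))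
  sound (¬∨l φ ψ γ d) ρ = ≤-trans (−⊔-elim (⟦ φ ⟧ ρ) (⟦ ψ ⟧ ρ)) (sound d ρ)
  sound (¬∨r Γ φ ψ d) ρ =
    from-context ρ Γ (≤-trans (to-context ρ Γ (sound d ρ)) (−⊔-intro (⟦ φ ⟧ ρ) (⟦ ψ ⟧ ρ)))
  sound (¬¬l φ γ d) ρ = ≤-trans (−−-elim (⟦ φ ⟧ ρ)) (sound d ρ)
  sound (¬¬r Γ φ d) ρ =
    from-context ρ Γ (≤-trans (to-context ρ Γ (sound d ρ)) (−−-intro (⟦ φ ⟧ ρ)))

  refuted-by : ∀ {φ} ρ → ¬ Designated (⟦ φ ⟧ ρ) → ¬ Prov φ
  refuted-by ρ undesignated d = undesignated (sound d ρ)

-- Truth values are 0,…,7, designated value 7, lattice order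
-- 0 < 1 < 2 < 5 < 6 < 7 and 1 < 3 < 4 < 6 (with 2,5 incomparable to 3,4);
-- negation is the order-reversing involution 0↔7, 1↔6, 2↔4, 3↔5.

V : Set
V = Fin 8

Row Table : Set
Row   = Vec V 8
Table = Vec Row 8

open import Agda.Builtin.FromNat using (Number; fromNat)
import Data.Unit as Unit

-- from here on numerals denote truth values; the range side condition of a
-- Fin literal computes to the unit type, supplied by the second instance
instance
  V-literal : Number V
  V-literal = Fin.number _
  bounded-literal : Unit.⊤
  bounded-literal = Unit.tt

module EightElementModel where

  infixr 5 _⊸ᵥ_
  infixr 6 _⊔ᵥ_
  infixr 7 _⊓ᵥ_
  infixr 8 _·ᵥ_
  infix 9 −ᵥ_
  infix 4 _≤ᵥ?_

  ⊸-table ·-table ⊓-table ⊔-table : Table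
  ⊸-table =
    (7 ∷ 7 ∷ 7 ∷ 7 ∷ 7 ∷ 7 ∷ 7 ∷ 7 ∷ []) ∷
    (6 ∷ 7 ∷ 7 ∷ 7 ∷ 7 ∷ 7 ∷ 7 ∷ 7 ∷ []) ∷
    (4 ∷ 4 ∷ 7 ∷ 4 ∷ 4 ∷ 7 ∷ 7 ∷ 7 ∷ []) ∷
    (5 ∷ 5 ∷ 5 ∷ 7 ∷ 7 ∷ 5 ∷ 7 ∷ 7 ∷ []) ∷
    (2 ∷ 5 ∷ 5 ∷ 6 ∷ 7 ∷ 5 ∷ 7 ∷ 7 ∷ []) ∷
    (3 ∷ 4 ∷ 6 ∷ 4 ∷ 4 ∷ 7 ∷ 7 ∷ 7 ∷ []) ∷
    (1 ∷ 1 ∷ 5 ∷ 4 ∷ 4 ∷ 5 ∷ 7 ∷ 7 ∷ []) ∷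
    (0 ∷ 1 ∷ 2 ∷ 3 ∷ 4 ∷ 5 ∷ 6 ∷ 7 ∷ []) ∷ []
  ·-table =
    (0 ∷ 0 ∷ 0 ∷ 0 ∷ 0 ∷ 0 ∷ 0 ∷ 0 ∷ []) ∷
    (0 ∷ 0 ∷ 0 ∷ 0 ∷ 0 ∷ 0 ∷ 0 ∷ 1 ∷ []) ∷
    (0 ∷ 0 ∷ 2 ∷ 0 ∷ 0 ∷ 2 ∷ 2 ∷ 2 ∷ []) ∷
    (0 ∷ 0 ∷ 0 ∷ 3 ∷ 3 ∷ 0 ∷ 3 ∷ 3 ∷ []) ∷
    (0 ∷ 0 ∷ 0 ∷ 3 ∷ 3 ∷ 1 ∷ 3 ∷ 4 ∷ []) ∷
    (0 ∷ 0 ∷ 2 ∷ 0 ∷ 1 ∷ 2 ∷ 2 ∷ 5 ∷ []) ∷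
    (0 ∷ 0 ∷ 2 ∷ 3 ∷ 3 ∷ 2 ∷ 6 ∷ 6 ∷ []) ∷
    (0 ∷ 1 ∷ 2 ∷ 3 ∷ 4 ∷ 5 ∷ 6 ∷ 7 ∷ []) ∷ []
  ⊓-table =
    (0 ∷ 0 ∷ 0 ∷ 0 ∷ 0 ∷ 0 ∷ 0 ∷ 0 ∷ []) ∷
    (0 ∷ 1 ∷ 1 ∷ 1 ∷ 1 ∷ 1 ∷ 1 ∷ 1 ∷ []) ∷
    (0 ∷ 1 ∷ 2 ∷ 1 ∷ 1 ∷ 2 ∷ 2 ∷ 2 ∷ []) ∷
    (0 ∷ 1 ∷ 1 ∷ 3 ∷ 3 ∷ 1 ∷ 3 ∷ 3 ∷ []) ∷
    (0 ∷ 1 ∷ 1 ∷ 3 ∷ 4 ∷ 1 ∷ 4 ∷ 4 ∷ []) ∷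
    (0 ∷ 1 ∷ 2 ∷ 1 ∷ 1 ∷ 5 ∷ 5 ∷ 5 ∷ []) ∷
    (0 ∷ 1 ∷ 2 ∷ 3 ∷ 4 ∷ 5 ∷ 6 ∷ 6 ∷ []) ∷
    (0 ∷ 1 ∷ 2 ∷ 3 ∷ 4 ∷ 5 ∷ 6 ∷ 7 ∷ []) ∷ []
  ⊔-table =
    (0 ∷ 1 ∷ 2 ∷ 3 ∷ 4 ∷ 5 ∷ 6 ∷ 7 ∷ []) ∷
    (1 ∷ 1 ∷ 2 ∷ 3 ∷ 4 ∷ 5 ∷ 6 ∷ 7 ∷ []) ∷
    (2 ∷ 2 ∷ 2 ∷ 6 ∷ 6 ∷ 5 ∷ 6 ∷ 7 ∷ []) ∷
    (3 ∷ 3 ∷ 6 ∷ 3 ∷ 4 ∷ 6 ∷ 6 ∷ 7 ∷ []) ∷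
    (4 ∷ 4 ∷ 6 ∷ 4 ∷ 4 ∷ 6 ∷ 6 ∷ 7 ∷ []) ∷
    (5 ∷ 5 ∷ 5 ∷ 6 ∷ 6 ∷ 5 ∷ 6 ∷ 7 ∷ []) ∷
    (6 ∷ 6 ∷ 6 ∷ 6 ∷ 6 ∷ 6 ∷ 6 ∷ 7 ∷ []) ∷
    (7 ∷ 7 ∷ 7 ∷ 7 ∷ 7 ∷ 7 ∷ 7 ∷ 7 ∷ []) ∷ []

  negation : Row
  negation = 7 ∷ 6 ∷ 4 ∷ 5 ∷ 2 ∷ 3 ∷ 1 ∷ 0 ∷ []

  operation : Table → V → V → V
  operation t x y = lookup (lookup t x) y

  _⊸ᵥ_ _·ᵥ_ _⊓ᵥ_ _⊔ᵥ_ : V → V → V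
  _⊸ᵥ_ = operation ⊸-table
  _·ᵥ_ = operation ·-table
  _⊓ᵥ_ = operation ⊓-table
  _⊔ᵥ_ = operation ⊔-table

  −ᵥ_ : V → V
  −ᵥ_ = lookup negation

  Designatedᵥ : V → Set
  Designatedᵥ x = x ≡ 7

  _≤ᵥ?_ : ∀ x y → Dec (Designatedᵥ (x ⊸ᵥ y))
  x ≤ᵥ? y = x ⊸ᵥ y ≟ 7

  by-exhaustion : ∀ {A : Set} (decision : Dec A) {_ : True decision} → A
  by-exhaustion _ {holds} = toWitness holds

  model : Model
  model = record
    { Carrier       = V
    ; _⊸_           = _⊸ᵥ_
    ; _⊓_           = _⊓ᵥ_
    ; _⊔_           = _⊔ᵥ_
    ; _·_           = _·ᵥ_
    ; −_            = −ᵥ_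
    ; ⊥             = 0
    ; ⊤             = 7
    ; Designated    = Designatedᵥ
    ; ·-comm        = by-exhaustion (all? λ x → all? λ y → x ·ᵥ y ≟ y ·ᵥ x)
    ; ·-assoc       = by-exhaustion (all? λ x → all? λ y → all? λ z → (x ·ᵥ y) ·ᵥ z ≟ x ·ᵥ (y ·ᵥ z))
    ; ·-3-potent    = by-exhaustion (all? λ x → x ·ᵥ (x ·ᵥ x) ≟ x ·ᵥ x)
    ; ·-identityˡ   = by-exhaustion (all? λ x → 7 ·ᵥ x ≟ x)
    ; ⊸-curry       = by-exhaustion (all? λ x → all? λ y → all? λ z → x ⊸ᵥ y ⊸ᵥ z ≟ (x ·ᵥ y) ⊸ᵥ z)
    ; ⊤-⊸           = by-exhaustion (all? λ x → 7 ⊸ᵥ x ≟ x)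
    ; ≤-refl        = by-exhaustion (all? λ x → x ≤ᵥ? x)
    ; ≤-trans       = λ {x y z} → by-exhaustion (all? λ x → all? λ y → all? λ z →
                        x ≤ᵥ? y →-dec y ≤ᵥ? z →-dec x ≤ᵥ? z) x y z
    ; ⊥-least       = by-exhaustion (all? λ x → 0 ≤ᵥ? x)
    ; −-⊸⊥          = by-exhaustion (all? λ x → −ᵥ x ≤ᵥ? x ⊸ᵥ 0)
    ; −⊥-designated = refl
    ; contrapose    = by-exhaustion (all? λ x → all? λ y → x ⊸ᵥ y ≤ᵥ? −ᵥ y ⊸ᵥ −ᵥ x)
    ; contrapose⁻¹  = by-exhaustion (all? λ x → all? λ y → −ᵥ y ⊸ᵥ −ᵥ x ≤ᵥ? x ⊸ᵥ y)
    ; designated-⊸  = λ y → λ { refl → by-exhaustion (all? λ y → y ≤ᵥ? 7) y }  -- 7 is the only designated value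
    ; ⊸-left        = λ {c x y z} → by-exhaustion (all? λ c → all? λ x → all? λ y → all? λ z →
                        c ≤ᵥ? x →-dec y ≤ᵥ? z →-dec c ≤ᵥ? (x ⊸ᵥ y) ⊸ᵥ z) c x y z
    ; ⊓-lowerˡ      = by-exhaustion (all? λ x → all? λ y → x ⊓ᵥ y ≤ᵥ? x)
    ; ⊓-lowerʳ      = by-exhaustion (all? λ x → all? λ y → x ⊓ᵥ y ≤ᵥ? y)
    ; ⊓-greatest    = λ {c x y} → by-exhaustion (all? λ c → all? λ x → all? λ y →
                        c ≤ᵥ? x →-dec c ≤ᵥ? y →-dec c ≤ᵥ? x ⊓ᵥ y) c x y
    ; ⊔-upperˡ      = by-exhaustion (all? λ x → all? λ y → x ≤ᵥ? x ⊔ᵥ y)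
    ; ⊔-upperʳ      = by-exhaustion (all? λ x → all? λ y → y ≤ᵥ? x ⊔ᵥ y)
    ; ⊔-least       = λ {x y z} → by-exhaustion (all? λ x → all? λ y → all? λ z →
                        x ≤ᵥ? z →-dec y ≤ᵥ? z →-dec x ⊔ᵥ y ≤ᵥ? z) x y z
    ; ⊔-least²      = λ {x y z} → by-exhaustion (all? λ x → all? λ y → all? λ z →
                        x ≤ᵥ? x ⊸ᵥ z →-dec y ≤ᵥ? y ⊸ᵥ z →-dec x ⊔ᵥ y ≤ᵥ? (x ⊔ᵥ y) ⊸ᵥ z) x y z
    ; −⊸-elim       = by-exhaustion (all? λ x → all? λ y → −ᵥ (x ⊸ᵥ y) ≤ᵥ? x ⊓ᵥ −ᵥ y)
    ; −⊸-intro      = λ {c x y} → by-exhaustion (all? λ c → all? λ x → all? λ y →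
                        c ·ᵥ c ≟ c →-dec c ≤ᵥ? x ⊓ᵥ −ᵥ y →-dec c ≤ᵥ? −ᵥ (x ⊸ᵥ y)) c x y
    ; −⊓-elim       = by-exhaustion (all? λ x → all? λ y → −ᵥ (x ⊓ᵥ y) ≤ᵥ? −ᵥ x ⊔ᵥ −ᵥ y)
    ; −⊓-intro      = by-exhaustion (all? λ x → all? λ y → −ᵥ x ⊔ᵥ −ᵥ y ≤ᵥ? −ᵥ (x ⊓ᵥ y))
    ; −⊔-elim       = by-exhaustion (all? λ x → all? λ y → −ᵥ (x ⊔ᵥ y) ≤ᵥ? −ᵥ x ⊓ᵥ −ᵥ y)
    ; −⊔-intro      = by-exhaustion (all? λ x → all? λ y → −ᵥ x ⊓ᵥ −ᵥ y ≤ᵥ? −ᵥ (x ⊔ᵥ y))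
    ; −−-elim       = by-exhaustion (all? λ x → −ᵥ −ᵥ x ≤ᵥ? x)
    ; −−-intro      = by-exhaustion (all? λ x → x ≤ᵥ? −ᵥ −ᵥ x)
    }

  open Soundness model public using (refuted-by)

  ⟨_,_,_⟩ : V → V → V → ℕ → V
  ⟨ a , b , c ⟩ zero                = a
  ⟨ a , b , c ⟩ (suc zero)          = b
  ⟨ a , b , c ⟩ (suc (suc zero))    = c
  ⟨ a , b , c ⟩ (suc (suc (suc _))) = 0

open EightElementModel using (refuted-by; ⟨_,_,_⟩)

proposition5p1 : ¬ Prov (p ∨ ∼ p)
    × ¬ Prov (∼ (p ∧ ∼ p))
    × ¬ Prov ((p ∧ ∼ p) ⇒ q)
    × ¬ Prov ((p ⇒ (p ⇒ q)) ⇒ (p ⇒ q))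
    × ¬ Prov ((p ⇒ (q ⇒ r)) ⇒ ((p ∧ q) ⇒ r))
    × ¬ Prov ((p ∧ ∼ q) ⇒ ∼ (p ⇒ q))
    × ¬ Prov (((p ⇒ q) ⇒ q) ⇒ ((q ⇒ p) ⇒ p))
    × ¬ Prov ((p ∧ (q ∨ r)) ⇒ ((p ∧ q) ∨ (p ∧ r)))
    × ¬ Prov (((p ² ⇒ q) ∧ ((∼ q) ² ⇒ ∼ p)) ⇒ (p ⇒ q))
proposition5p1 =
    refuted-by ⟨ 1 , 0 , 0 ⟩ (λ ())
  , refuted-by ⟨ 1 , 0 , 0 ⟩ (λ ())
  , refuted-by ⟨ 1 , 0 , 0 ⟩ (λ ())
  , refuted-by ⟨ 1 , 0 , 0 ⟩ (λ ())
  , refuted-by ⟨ 1 , 1 , 0 ⟩ (λ ())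
  , refuted-by ⟨ 1 , 1 , 0 ⟩ (λ ())
  , refuted-by ⟨ 2 , 1 , 0 ⟩ (λ ())
  , refuted-by ⟨ 4 , 2 , 3 ⟩ (λ ())
  , refuted-by ⟨ 4 , 3 , 0 ⟩ (λ ())
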